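{- Let $n=6k+5$ with $k\ge 6$, and let $P(n,3)$ be the generalized Petersen graph with vertex set $\{u_1,\dots,u_n,v_1,\dots,v_n\}$ and edge set $\{u_iu_{i+1},\,u_iv_i,\,v_iv_{i+3}:1\le i\le n\}$ (subscripts modulo $n$). Then $\dim(P(n,3))\ge 4$.
   Context: For a connected graph $G$, an ordered set $W=\{w_1,\dots,w_m\}\subseteq V(G)$ is a resolving set if the vectors $r(z|W)=(d(z,w_1),\dots,d(z,w_m))$ of shortest-path distances are pairwise distinct over all $z\in V(G)$. The metric dimension $\dim(G)$ is the minimum cardinality of a resolving set of $G$. -}

module Defs where

open import Data.Nat using (ℕ; zero; suc; _+_; _<_; NonZero)
open import Data.Nat.DivMod using (_%_; m%n<n)
open import Data.Fin using (Fin; toℕ; fromℕ<)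
open import Data.Product using (_×_; ∃-syntax)
open import Data.List using (List)
open import Data.List.Membership.Propositional using (_∈_)
open import Relation.Nullary using (¬_)
open import Relation.Binary.PropositionalEquality using (_≡_)

data Walk {V : Set} (Adj : V → V → Set) : V → V → ℕ → Set where
  here : ∀ {x} → Walk Adj x x zero
  step : ∀ {x y z ℓ} → Adj x y → Walk Adj y z ℓ → Walk Adj x z (suc ℓ)

IsDist : {V : Set} → (V → V → Set) → V → V → ℕ → Set
IsDist Adj x y d = Walk Adj x y d × (∀ m → m < d → ¬ Walk Adj x y m)

SameDist : {V : Set} → (V → V → Set) → V → V → V → Set
SameDist Adj w z z' = ∃[ d ] (IsDist Adj z w d × IsDist Adj z' w d)

Resolving : {V : Set} → (V → V → Set) → List V → Set
Resolving Adj W = ∀ z z' → (∀ w → w ∈ W → SameDist Adj w z z') → z ≡ z'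

-- Generalized Petersen graph P(n,3); indices 0..n-1 modulo n

data PVtx (n : ℕ) : Set where
  u : Fin n → PVtx n
  v : Fin n → PVtx n

_⊕_ : ∀ {n} .{{_ : NonZero n}} → Fin n → ℕ → Fin n
_⊕_ {n} i j = fromℕ< (m%n<n (toℕ i + j) n)

data P3Adj (n : ℕ) .{{_ : NonZero n}} : PVtx n → PVtx n → Set where
  outer  : ∀ i → P3Adj n (u i) (u (i ⊕ 1))
  outer' : ∀ i → P3Adj n (u (i ⊕ 1)) (u i)
  spoke  : ∀ i → P3Adj n (u i) (v i)
  spoke' : ∀ i → P3Adj n (v i) (u i)
  inner  : ∀ i → P3Adj n (v i) (v (i ⊕ 3))
  inner' : ∀ i → P3Adj n (v (i ⊕ 3)) (v i)

{-# OPTIONS --safe #-}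

-- Seen from a vertex (σ, s), the vertex (τ, s + x) lies at distance
-- Δ σ τ x = min (δ σ τ x) (δ σ τ (n − x)), where δ is the distance in the infinite cover of P(n,3).
-- A potential argument certifies this: Δ is 1-Lipschitz along edges and can always be decreased by one
-- step; n ≥ 41 keeps the two ways round the cycle from interfering.
--
-- Three landmarks cut the cycle into gaps X, Y, Z with X + Y + Z = n ≡ 2 (mod 3), and two cyclically
-- consecutive gaps are either both short (≤ 9) or both long. If they are short, the landmarks lie in a
-- window of length 18, and a finite search finds two vertices near it that no landmark separates.
-- If they are long, counting residues shows that after the landmark opening one of these gaps there is
-- a t, 4 or 5 steps on, such that every landmark lies at an offset r ≢ 2 (mod 3) from t; such a landmark
-- cannot separate u_t from u_{t+2}, because going either way round the offsets to compare are y and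
-- 2 + y with 3 ∤ y, and δ U τ (2 + y) = δ U τ y for those.

module Submission where

open import Data.Empty using (⊥-elim)
open import Data.Fin using (Fin; toℕ; fromℕ<)
open import Data.Fin.Properties using (toℕ-fromℕ<; toℕ-injective; toℕ<n)
open import Data.List using (List; []; _∷_; concatMap; map; upTo; length)
open import Data.List.Membership.Propositional using (_∈_)
open import Data.List.Relation.Binary.Subset.Propositional using (_⊆_)
open import Data.List.Relation.Unary.Any using (Any; any?; satisfied; here; there)
open import Data.List.Relation.Unary.Unique.Propositional using (Unique)
open import Data.Nat
open import Data.Nat.DivMod
open import Data.Nat.Divisibility using (m%n≡0⇒n∣m; ∣-refl)
open import Data.Nat.Properties
open import Data.Product using (Σ; ∃; ∃-syntax; _×_; _,_; proj₁; proj₂)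
open import Data.Product.Properties using (,-injectiveʳ)
open import Data.Sum as Sum using (_⊎_; inj₁; inj₂)
open import Function using (_∘_; id)
open import Relation.Binary.Definitions using (Symmetric)
open import Relation.Binary.PropositionalEquality
open import Relation.Nullary using (¬_; Dec; yes; no)
open import Relation.Nullary.Decidable using (from-yes; _×-dec_; _⊎-dec_; _→-dec_; ¬?)

open import Defs

-- Distances from a potential

module _ {V : Set} {Adj : V → V → Set} where

  walk-snoc : ∀ {x y z ℓ} → Walk Adj x y ℓ → Adj y z → Walk Adj x z (suc ℓ)
  walk-snoc here        e = step e here
  walk-snoc (step e′ w) e = step e′ (walk-snoc w e)

  walk-reverse : Symmetric Adj → ∀ {x y ℓ} → Walk Adj x y ℓ → Walk Adj y x ℓ
  walk-reverse sym-adj here       = here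
  walk-reverse sym-adj (step e w) = walk-snoc (walk-reverse sym-adj w) (sym-adj e)

  IsDist-sym : Symmetric Adj → ∀ {x y d} → IsDist Adj x y d → IsDist Adj y x d
  IsDist-sym sym-adj (w , shortest) =
    walk-reverse sym-adj w , λ m m<d w′ → shortest m m<d (walk-reverse sym-adj w′)

  record DistancePotential (s : V) (h : V → ℕ) : Set where
    field
      vanishes-at-target : h s ≡ 0
      vanishes-only-at-target : ∀ x → h x ≡ 0 → x ≡ s
      lipschitz : ∀ {x y} → Adj x y → h x ≤ suc (h y)
      descent : ∀ x → 0 < h x → ∃[ y ] Adj x y × h y < h x

  module _ {s : V} {h : V → ℕ} (pot : DistancePotential s h) where
    open DistancePotential pot

    private
      walk-to-target : ∀ m x → h x ≡ m → Walk Adj x s m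
      walk-to-target zero x hx≡0 = subst (λ z → Walk Adj z s 0) (sym (vanishes-only-at-target x hx≡0)) here
      walk-to-target (suc m) x hx≡1+m with descent x (subst (0 <_) (sym hx≡1+m) z<s)
      ... | y , e , hy<hx = step e (walk-to-target m y (≤-antisym hy≤m m≤hy))
        where
          hy≤m : h y ≤ m
          hy≤m = ≤-pred (subst (h y <_) hx≡1+m hy<hx)
          m≤hy : m ≤ h y
          m≤hy = ≤-pred (subst (_≤ suc (h y)) hx≡1+m (lipschitz e))

      potential≤length : ∀ {x m} → Walk Adj x s m → h x ≤ m
      potential≤length here       = ≤-reflexive vanishes-at-target
      potential≤length (step e w) = ≤-trans (lipschitz e) (s≤s (potential≤length w))

    potential-IsDist : ∀ x → IsDist Adj x s (h x)
    potential-IsDist x = walk-to-target (h x) x refl , λ m m<hx w → <⇒≱ m<hx (potential≤length w)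

-- Arithmetic modulo n

[m%d+k]%d≡[m+k]%d : ∀ m k d .{{_ : NonZero d}} → (m % d + k) % d ≡ (m + k) % d
[m%d+k]%d≡[m+k]%d m k d = begin
  (m % d + k) % d         ≡⟨ %-distribˡ-+ (m % d) k d ⟩
  (m % d % d + k % d) % d ≡⟨ cong (λ r → (r + k % d) % d) (m%n%n≡m%n m d) ⟩
  (m % d + k % d) % d     ≡⟨ %-distribˡ-+ m k d ⟨
  (m + k) % d             ∎
  where open ≡-Reasoning

[m+k%d]%d≡[m+k]%d : ∀ m k d .{{_ : NonZero d}} → (m + k % d) % d ≡ (m + k) % d
[m+k%d]%d≡[m+k]%d m k d = begin
  (m + k % d) % d ≡⟨ cong (_% d) (+-comm m (k % d)) ⟩
  (k % d + m) % d ≡⟨ [m%d+k]%d≡[m+k]%d k m d ⟩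
  (k + m) % d     ≡⟨ cong (_% d) (+-comm k m) ⟩
  (m + k) % d     ∎
  where open ≡-Reasoning

module Cyclic (n : ℕ) .{{_ : NonZero n}} where

  infixl 6 _⊞_ _⊟_

  _⊞_ : ℕ → ℕ → ℕ
  a ⊞ b = (a + b) % n

  -- a − b modulo n, meaningful for b ≤ n
  _⊟_ : ℕ → ℕ → ℕ
  a ⊟ b = (a + (n ∸ b)) % n

  ⊞<n : ∀ a b → a ⊞ b < n
  ⊞<n a b = m%n<n (a + b) n

  ⊟<n : ∀ a b → a ⊟ b < n
  ⊟<n a b = m%n<n (a + (n ∸ b)) n

  ⊞-assoc : ∀ a b c → (a ⊞ b) ⊞ c ≡ a ⊞ (b + c)
  ⊞-assoc a b c = trans ([m%d+k]%d≡[m+k]%d (a + b) c n) (cong (_% n) (+-assoc a b c))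

  ⊞-identityʳ : ∀ {a} → a < n → a ⊞ 0 ≡ a
  ⊞-identityʳ {a} a<n = trans (cong (_% n) (+-identityʳ a)) (m<n⇒m%n≡m a<n)

  ⊞-+n : ∀ a b → a ⊞ (b + n) ≡ a ⊞ b
  ⊞-+n a b = trans (cong (_% n) (sym (+-assoc a b n))) ([m+n]%n≡m%n (a + b) n)

  ⊞-⊟ : ∀ {a b} → a < n → b ≤ n → b ⊞ (a ⊟ b) ≡ a
  ⊞-⊟ {a} {b} a<n b≤n = begin
    (b + (a + (n ∸ b)) % n) % n ≡⟨ [m+k%d]%d≡[m+k]%d b (a + (n ∸ b)) n ⟩
    (b + (a + (n ∸ b))) % n     ≡⟨ cong (_% n) (+-comm b (a + (n ∸ b))) ⟩
    (a + (n ∸ b) + b) % n       ≡⟨ cong (_% n) (+-assoc a (n ∸ b) b) ⟩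
    (a + ((n ∸ b) + b)) % n     ≡⟨ cong (λ m → (a + m) % n) (m∸n+n≡m b≤n) ⟩
    (a + n) % n                 ≡⟨ [m+n]%n≡m%n a n ⟩
    a % n                       ≡⟨ m<n⇒m%n≡m a<n ⟩
    a                           ∎
    where open ≡-Reasoning

  ⊞-⊟-cancel : ∀ {b y} → b ≤ n → y < n → (b ⊞ y) ⊟ b ≡ y
  ⊞-⊟-cancel {b} {y} b≤n y<n = begin
    ((b + y) % n + (n ∸ b)) % n ≡⟨ [m%d+k]%d≡[m+k]%d (b + y) (n ∸ b) n ⟩
    (b + y + (n ∸ b)) % n       ≡⟨ cong (λ m → (m + (n ∸ b)) % n) (+-comm b y) ⟩
    (y + b + (n ∸ b)) % n       ≡⟨ cong (_% n) (+-assoc y b (n ∸ b)) ⟩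
    (y + (b + (n ∸ b))) % n     ≡⟨ cong (λ m → (y + m) % n) (m+[n∸m]≡n b≤n) ⟩
    (y + n) % n                 ≡⟨ [m+n]%n≡m%n y n ⟩
    y % n                       ≡⟨ m<n⇒m%n≡m y<n ⟩
    y                           ∎
    where open ≡-Reasoning

  ⊟-unique : ∀ {a b y} → b ≤ n → y < n → b ⊞ y ≡ a → a ⊟ b ≡ y
  ⊟-unique b≤n y<n refl = ⊞-⊟-cancel b≤n y<n

  ⊞-wrap : ∀ {x y d} → x + y ≡ n → y ≤ d → d < n → x ⊞ d ≡ d ∸ y
  ⊞-wrap {x} {y} {d} x+y≡n y≤d d<n = begin
    (x + d) % n           ≡⟨ cong (λ m → (x + m) % n) (m+[n∸m]≡n y≤d) ⟨
    (x + (y + (d ∸ y))) % n ≡⟨ cong (_% n) (+-assoc x y (d ∸ y)) ⟨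
    (x + y + (d ∸ y)) % n   ≡⟨ cong (λ m → (m + (d ∸ y)) % n) x+y≡n ⟩
    (n + (d ∸ y)) % n       ≡⟨ cong (_% n) (+-comm n (d ∸ y)) ⟩
    ((d ∸ y) + n) % n       ≡⟨ [m+n]%n≡m%n (d ∸ y) n ⟩
    (d ∸ y) % n             ≡⟨ m<n⇒m%n≡m (≤-<-trans (m∸n≤m d y) d<n) ⟩
    d ∸ y                   ∎
    where open ≡-Reasoning

  ⊞-⊞-inverse : ∀ {a d} → a < n → d ≤ n → (a ⊞ (n ∸ d)) ⊞ d ≡ a
  ⊞-⊞-inverse {a} {d} a<n d≤n = begin
    (a ⊞ (n ∸ d)) ⊞ d   ≡⟨ ⊞-assoc a (n ∸ d) d ⟩
    a ⊞ ((n ∸ d) + d)   ≡⟨ cong (a ⊞_) (m∸n+n≡m d≤n) ⟩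
    a ⊞ n               ≡⟨ ⊞-+n a 0 ⟩
    a ⊞ 0               ≡⟨ ⊞-identityʳ a<n ⟩
    a                   ∎
    where open ≡-Reasoning

  ⊞-⊟-assoc : ∀ {a b} e → a < n → b ≤ n → (a ⊞ e) ⊟ b ≡ (a ⊟ b) ⊞ e
  ⊞-⊟-assoc {a} {b} e a<n b≤n = ⊟-unique b≤n (⊞<n (a ⊟ b) e) (begin
    b ⊞ ((a ⊟ b) ⊞ e)       ≡⟨ [m+k%d]%d≡[m+k]%d b ((a ⊟ b) + e) n ⟩
    (b + ((a ⊟ b) + e)) % n ≡⟨ cong (_% n) (+-assoc b (a ⊟ b) e) ⟨
    (b + (a ⊟ b) + e) % n   ≡⟨ [m%d+k]%d≡[m+k]%d (b + (a ⊟ b)) e n ⟨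
    (b ⊞ (a ⊟ b)) ⊞ e       ≡⟨ cong (_⊞ e) (⊞-⊟ a<n b≤n) ⟩
    a ⊞ e                   ∎)
    where open ≡-Reasoning

  ⊞-⊟-back : ∀ {a b d} → a < n → b ≤ n → d ≤ a ⊟ b → (a ⊞ (n ∸ d)) ⊟ b ≡ (a ⊟ b) ∸ d
  ⊞-⊟-back {a} {b} {d} a<n b≤n d≤c = ⊟-unique b≤n (≤-<-trans (m∸n≤m c d) (⊟<n a b)) (sym (begin
    a ⊞ (n ∸ d)                    ≡⟨ cong (_⊞ (n ∸ d)) (⊞-⊟ a<n b≤n) ⟨
    (b ⊞ c) ⊞ (n ∸ d)              ≡⟨ ⊞-assoc b c (n ∸ d) ⟩
    b ⊞ (c + (n ∸ d))              ≡⟨ cong (λ m → b ⊞ (m + (n ∸ d))) (m∸n+n≡m d≤c) ⟨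
    b ⊞ ((c ∸ d) + d + (n ∸ d))    ≡⟨ cong (b ⊞_) (+-assoc (c ∸ d) d (n ∸ d)) ⟩
    b ⊞ ((c ∸ d) + (d + (n ∸ d)))  ≡⟨ cong (λ m → b ⊞ ((c ∸ d) + m)) (m+[n∸m]≡n d≤n) ⟩
    b ⊞ ((c ∸ d) + n)              ≡⟨ ⊞-+n b (c ∸ d) ⟩
    b ⊞ (c ∸ d)                    ∎))
    where
      open ≡-Reasoning
      c : ℕ
      c = a ⊟ b
      d≤n : d ≤ n
      d≤n = ≤-trans d≤c (<⇒≤ (⊟<n a b))

  ⊞-⊟-shift : ∀ z {a b} → a < n → b < n → (z ⊞ a) ⊟ (z ⊞ b) ≡ a ⊟ b
  ⊞-⊟-shift z {a} {b} a<n b<n = ⊟-unique (<⇒≤ (⊞<n z b)) (⊟<n a b) (begin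
    (z ⊞ b) ⊞ (a ⊟ b)        ≡⟨ ⊞-assoc z b (a ⊟ b) ⟩
    (z + (b + (a ⊟ b))) % n  ≡⟨ [m+k%d]%d≡[m+k]%d z (b + (a ⊟ b)) n ⟨
    z ⊞ (b ⊞ (a ⊟ b))        ≡⟨ cong (z ⊞_) (⊞-⊟ a<n (<⇒≤ b<n)) ⟩
    z ⊞ a                    ∎)
    where open ≡-Reasoning

  ⊟-self : ∀ {a} → a < n → a ⊟ a ≡ 0
  ⊟-self a<n = ⊟-unique (<⇒≤ a<n) (≤-<-trans z≤n a<n) (⊞-identityʳ a<n)

  ⊞-cancelˡ : ∀ {b y y′} → b ≤ n → y < n → y′ < n → b ⊞ y ≡ b ⊞ y′ → y ≡ y′
  ⊞-cancelˡ b≤n y<n y′<n eq = trans (sym (⊞-⊟-cancel b≤n y<n)) (⊟-unique b≤n y′<n (sym eq))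

-- Distances in the infinite cover

data Layer : Set where
  U V : Layer

-- δ σ τ y is the distance from (σ, 0) to (τ, y) in the infinite cover of P(n,3):
-- vertices Layer × ℤ, edges (U,i)(U,i+1), (U,i)(V,i), (V,i)(V,i+3).
δUV : ℕ → ℕ
δUV 0 = 1
δUV 1 = 2
δUV 2 = 3
δUV (suc (suc (suc y))) = suc (δUV y)

δVV : ℕ → ℕ
δVV 0 = 0
δVV 1 = 3
δVV 2 = 4
δVV (suc (suc (suc y))) = suc (δVV y)

δUU : ℕ → ℕ
δUU y = y ⊓ suc (δUV y)

δ : Layer → Layer → ℕ → ℕ
δ U U = δUU
δ U V = δUV
δ V U = δUV
δ V V = δVV

Near : ℕ → ℕ → Set
Near a b = a ≤ suc b × b ≤ suc a

near-sym : ∀ {a b} → Near a b → Near b a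
near-sym (a≤1+b , b≤1+a) = b≤1+a , a≤1+b

near-suc : ∀ a → Near a (suc a)
near-suc a = m≤n⇒m≤1+n (n≤1+n a) , ≤-refl

near-⊓ : ∀ {a a′ b b′} → Near a a′ → Near b b′ → Near (a ⊓ b) (a′ ⊓ b′)
near-⊓ (p , q) (r , s) = ⊓-mono-≤ p r , ⊓-mono-≤ q s

near-cong-suc : ∀ {a b} → Near a b → Near (suc a) (suc b)
near-cong-suc (p , q) = s≤s p , s≤s q

δUV≤1+y : ∀ y → δUV y ≤ suc y
δUV≤1+y 0 = ≤-refl
δUV≤1+y 1 = ≤-refl
δUV≤1+y 2 = ≤-refl
δUV≤1+y (suc (suc (suc y))) = s≤s (≤-trans (δUV≤1+y y) (m≤n+m (suc y) 2))

δUV-near-suc : ∀ y → Near (δUV y) (δUV (suc y))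
δUV-near-suc 0 = near-suc 1
δUV-near-suc 1 = near-suc 2
δUV-near-suc 2 = near-sym (near-suc 2)
δUV-near-suc (suc (suc (suc y))) = near-cong-suc (δUV-near-suc y)

δUU-near-δUV : ∀ y → Near (δUU y) (δUV y)
δUU-near-δUV y = m⊓n≤n y (suc (δUV y)) , ⊓-glb (δUV≤1+y y) (m≤n⇒m≤1+n (n≤1+n (δUV y)))

δUV-near-δVV : ∀ y → Near (δUV y) (δVV y)
δUV-near-δVV 0 = near-sym (near-suc 0)
δUV-near-δVV 1 = near-suc 2
δUV-near-δVV 2 = near-suc 3
δUV-near-δVV (suc (suc (suc y))) = near-cong-suc (δUV-near-δVV y)

δ-near-spoke : ∀ σ y → Near (δ σ U y) (δ σ V y)
δ-near-spoke U y = δUU-near-δUV y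
δ-near-spoke V y = δUV-near-δVV y

δ-near-outer : ∀ σ y → Near (δ σ U y) (δ σ U (1 + y))
δ-near-outer U y = near-⊓ (near-suc y) (near-cong-suc (δUV-near-suc y))
δ-near-outer V y = δUV-near-suc y

δ-near-inner : ∀ σ y → Near (δ σ V y) (δ σ V (3 + y))
δ-near-inner U y = near-suc (δUV y)
δ-near-inner V y = near-suc (δVV y)

-- The same edges crossing the origin: from offset −y (at distance δ y, by the symmetry i ↦ −i) to d ∸ y.
δ-near-outer-across : ∀ σ y → 1 ≤ y → y ≤ 1 → Near (δ σ U y) (δ σ U (1 ∸ y))
δ-near-outer-across σ 1 _ _ = near-sym (δ-near-outer σ 0)
δ-near-outer-across σ (suc (suc _)) _ (s≤s ())

δ-near-inner-across : ∀ σ y → 1 ≤ y → y ≤ 3 → Near (δ σ V y) (δ σ V (3 ∸ y))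
δ-near-inner-across U 1 _ _ = near-suc 2
δ-near-inner-across U 2 _ _ = near-sym (near-suc 2)
δ-near-inner-across U 3 _ _ = near-sym (near-suc 1)
δ-near-inner-across V 1 _ _ = near-suc 3
δ-near-inner-across V 2 _ _ = near-sym (near-suc 3)
δ-near-inner-across V 3 _ _ = near-sym (near-suc 0)
δ-near-inner-across _ (suc (suc (suc (suc _)))) _ (s≤s (s≤s (s≤s ())))

δUV-pos : ∀ y → 0 < δUV y
δUV-pos 0 = s≤s z≤n
δUV-pos 1 = s≤s z≤n
δUV-pos 2 = s≤s z≤n
δUV-pos (suc (suc (suc y))) = s≤s z≤n

δ-self : ∀ σ → δ σ σ 0 ≡ 0
δ-self U = refl
δ-self V = refl

δ≡0 : ∀ σ τ y → δ σ τ y ≡ 0 → y ≡ 0 × σ ≡ τ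
δ≡0 U U 0 _ = refl , refl
δ≡0 U V y δ≡0 = ⊥-elim (<⇒≢ (δUV-pos y) (sym δ≡0))
δ≡0 V U y δ≡0 = ⊥-elim (<⇒≢ (δUV-pos y) (sym δ≡0))
δ≡0 V V 0 _ = refl , refl
δ≡0 V V (suc (suc (suc y))) ()

-- (τ, i) is adjacent to (τ′, i ± d) in the cover.
data CoverEdge : Layer → Layer → ℕ → Set where
  u-step : CoverEdge U U 1
  v-step : CoverEdge V V 3
  uv-spoke : CoverEdge U V 0
  vu-spoke : CoverEdge V U 0

Descent : Layer → Layer → ℕ → Set
Descent σ τ y = ∃[ τ′ ] ∃[ d ] CoverEdge τ τ′ d × d ≤ y × δ σ τ′ (y ∸ d) < δ σ τ y

private
  δVU-descent : ∀ y → Descent V U y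
  δVU-descent 0 = V , 0 , uv-spoke , z≤n , s≤s z≤n
  δVU-descent 1 = U , 1 , u-step , s≤s z≤n , s≤s (s≤s z≤n)
  δVU-descent 2 = U , 1 , u-step , s≤s z≤n , s≤s (s≤s (s≤s z≤n))
  δVU-descent (suc (suc (suc y))) with δVU-descent y
  ... | τ′ , d , e , d≤y , δ< =
    τ′ , d , e , m≤n⇒m≤o+n 3 d≤y , subst (_< suc (δUV y)) (sym (shift τ′)) (s≤s δ<)
    where
      shift : ∀ τ′ → δ V τ′ (3 + y ∸ d) ≡ suc (δ V τ′ (y ∸ d))
      shift U = cong δUV (+-∸-assoc 3 d≤y)
      shift V = cong δVV (+-∸-assoc 3 d≤y)

δ-descent : ∀ σ τ y → 0 < δ σ τ y → Descent σ τ y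
δ-descent U U 1 _ = U , 1 , u-step , ≤-refl , s≤s z≤n
δ-descent U U 2 _ = U , 1 , u-step , s≤s z≤n , s≤s (s≤s z≤n)
δ-descent U U (suc (suc (suc y))) _ =
  V , 0 , uv-spoke , z≤n , subst (δUV (3 + y) <_) (sym (m≥n⇒m⊓n≡n (s≤s (s≤s (δUV≤1+y y))))) ≤-refl
δ-descent U V 0 _ = U , 0 , vu-spoke , z≤n , s≤s z≤n
δ-descent U V 1 _ = U , 0 , vu-spoke , z≤n , s≤s (s≤s z≤n)
δ-descent U V 2 _ = U , 0 , vu-spoke , z≤n , s≤s (s≤s (s≤s z≤n))
δ-descent U V (suc (suc (suc y))) _ = V , 3 , v-step , s≤s (s≤s (s≤s z≤n)) , ≤-refl
δ-descent V U y _ = δVU-descent y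
δ-descent V V 1 _ = U , 0 , vu-spoke , z≤n , s≤s (s≤s (s≤s z≤n))
δ-descent V V 2 _ = U , 0 , vu-spoke , z≤n , s≤s (s≤s (s≤s (s≤s z≤n)))
δ-descent V V (suc (suc (suc y))) _ = V , 3 , v-step , s≤s (s≤s (s≤s z≤n)) , ≤-refl

δ-short : ∀ σ τ {w} → w < 17 → δ σ τ w ≤ 8
δ-short U U = from-yes (allUpTo? (λ w → δUU w ≤? 8) 17)
δ-short U V = from-yes (allUpTo? (λ w → δUV w ≤? 8) 17)
δ-short V U = δ-short U V
δ-short V V = from-yes (allUpTo? (λ w → δVV w ≤? 8) 17)

δ-long : ∀ σ τ z → 8 ≤ δ σ τ (24 + z)
δ-long U U z = ⊓-glb (m≤n⇒m≤o+n 16 (m≤m+n 8 z)) (m≤n⇒m≤1+n (m≤m+n 8 (δUV z)))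
δ-long U V z = m≤m+n 8 (δUV z)
δ-long V U z = m≤m+n 8 (δUV z)
δ-long V V z = m≤m+n 8 (δVV z)

δ-short≤long : ∀ σ τ {w y} → w ≤ 16 → 41 ≤ w + y → δ σ τ w ≤ δ σ τ y
δ-short≤long σ τ {w} {y} w≤16 41≤w+y =
  ≤-trans (δ-short σ τ (s≤s w≤16))
          (subst (λ y → 8 ≤ δ σ τ y) (m+[n∸m]≡n 24≤y) (δ-long σ τ (y ∸ 24)))
  where
    24≤y : 24 ≤ y
    24≤y = +-cancelˡ-≤ 16 24 y (≤-trans (n≤1+n 40) (≤-trans 41≤w+y (+-monoˡ-≤ y w≤16)))

δUV-2+ : ∀ y → y % 3 ≢ 0 → δUV (2 + y) ≡ δUV y
δUV-2+ 0 y≢0 = ⊥-elim (y≢0 refl)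
δUV-2+ 1 _ = refl
δUV-2+ 2 _ = refl
δUV-2+ (suc (suc (suc y))) y≢0 = cong suc (δUV-2+ y (y≢0 ∘ trans (%-remove-+ˡ y ∣-refl)))

δUU≡1+δUV : ∀ {y} → 3 ≤ y → δUU y ≡ suc (δUV y)
δUU≡1+δUV {suc (suc (suc y))} (s≤s (s≤s (s≤s _))) = m≥n⇒m⊓n≡n (s≤s (s≤s (δUV≤1+y y)))

δU-2+ : ∀ τ {y} → 3 ≤ y → y % 3 ≢ 0 → δ U τ (2 + y) ≡ δ U τ y
δU-2+ U 3≤y y≢0 = begin
  δUU (2 + _)       ≡⟨ δUU≡1+δUV (m≤n⇒m≤o+n 2 3≤y) ⟩
  suc (δUV (2 + _)) ≡⟨ cong suc (δUV-2+ _ y≢0) ⟩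
  suc (δUV _)       ≡⟨ δUU≡1+δUV 3≤y ⟨
  δUU _             ∎
  where open ≡-Reasoning
δU-2+ V _ y≢0 = δUV-2+ _ y≢0

-- Distances in P(n,3)

module CycleDistance (n : ℕ) .{{_ : NonZero n}} (41≤n : 41 ≤ n) where

  open Cyclic n

  Δ : Layer → Layer → ℕ → ℕ
  Δ σ τ x = δ σ τ x ⊓ δ σ τ (n ∸ x)

  δ-short≤far : ∀ σ τ {w} → w ≤ 16 → w ≤ n → δ σ τ w ≤ δ σ τ (n ∸ w)
  δ-short≤far σ τ w≤16 w≤n = δ-short≤long σ τ w≤16 (subst (41 ≤_) (sym (m+[n∸m]≡n w≤n)) 41≤n)

  Δ-short : ∀ σ τ {x} → x ≤ 16 → x ≤ n → Δ σ τ x ≡ δ σ τ x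
  Δ-short σ τ x≤16 x≤n = m≤n⇒m⊓n≡m (δ-short≤far σ τ x≤16 x≤n)

  Δ-short-back : ∀ σ τ {w} → w ≤ 16 → w ≤ n → Δ σ τ (n ∸ w) ≡ δ σ τ w
  Δ-short-back σ τ {w} w≤16 w≤n = begin
    δ σ τ (n ∸ w) ⊓ δ σ τ (n ∸ (n ∸ w)) ≡⟨ cong (λ z → δ σ τ (n ∸ w) ⊓ δ σ τ z) (m∸[m∸n]≡n w≤n) ⟩
    δ σ τ (n ∸ w) ⊓ δ σ τ w             ≡⟨ m≥n⇒m⊓n≡n (δ-short≤far σ τ w≤16 w≤n) ⟩
    δ σ τ w                             ∎
    where open ≡-Reasoning

  Δ-near-step : ∀ σ τ d → d ≤ 3 →
                (∀ y → Near (δ σ τ y) (δ σ τ (d + y))) →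
                (∀ y → 1 ≤ y → y ≤ d → Near (δ σ τ y) (δ σ τ (d ∸ y))) →
                ∀ {x} → x < n → Near (Δ σ τ x) (Δ σ τ (x ⊞ d))
  Δ-near-step σ τ d d≤3 forward across {x} x<n with x + d <? n
  ... | yes x+d<n =
    subst (λ z → Near (Δ σ τ x) (Δ σ τ z)) (sym (m<n⇒m%n≡m x+d<n))
      (near-⊓ (subst (λ z → Near (δ σ τ x) (δ σ τ z)) (+-comm d x) (forward x))
              (subst (λ z → Near (δ σ τ z) (δ σ τ (n ∸ (x + d)))) (sym n∸x≡d+r) (near-sym (forward _))))
    where
      n∸x≡d+r : n ∸ x ≡ d + (n ∸ (x + d))
      n∸x≡d+r = begin
        n ∸ x                   ≡⟨ cong (_∸ x) (m+[n∸m]≡n (<⇒≤ x+d<n)) ⟨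
        x + d + (n ∸ (x + d)) ∸ x ≡⟨ cong (_∸ x) (+-assoc x d _) ⟩
        x + (d + (n ∸ (x + d))) ∸ x ≡⟨ m+n∸m≡n x _ ⟩
        d + (n ∸ (x + d))       ∎
        where open ≡-Reasoning
  ... | no x+d≮n = subst₂ Near (sym Δx≡δy) (sym Δ[x⊞d]≡δ[d∸y]) (across y (m<n⇒0<n∸m x<n) y≤d)
    where
      y : ℕ
      y = n ∸ x
      d≤16 : d ≤ 16
      d≤16 = ≤-trans d≤3 (m≤m+n 3 13)
      d<n : d < n
      d<n = ≤-trans (s≤s d≤16) (≤-trans (m≤m+n 17 24) 41≤n)
      x+y≡n : x + y ≡ n
      x+y≡n = m+[n∸m]≡n (<⇒≤ x<n)
      y≤d : y ≤ d
      y≤d = +-cancelˡ-≤ x y d (subst (_≤ x + d) (sym x+y≡n) (≮⇒≥ x+d≮n))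
      Δx≡δy : Δ σ τ x ≡ δ σ τ y
      Δx≡δy = subst (λ z → Δ σ τ z ≡ δ σ τ y) (m∸[m∸n]≡n (<⇒≤ x<n))
                (Δ-short-back σ τ (≤-trans y≤d d≤16) (m∸n≤m n x))
      Δ[x⊞d]≡δ[d∸y] : Δ σ τ (x ⊞ d) ≡ δ σ τ (d ∸ y)
      Δ[x⊞d]≡δ[d∸y] = trans (cong (Δ σ τ) (⊞-wrap x+y≡n y≤d d<n))
                        (Δ-short σ τ (≤-trans (m∸n≤m d y) d≤16) (≤-trans (m∸n≤m d y) (<⇒≤ d<n)))

  Δ-near-outer : ∀ σ {x} → x < n → Near (Δ σ U x) (Δ σ U (x ⊞ 1))
  Δ-near-outer σ = Δ-near-step σ U 1 (s≤s z≤n) (δ-near-outer σ) (δ-near-outer-across σ)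

  Δ-near-inner : ∀ σ {x} → x < n → Near (Δ σ V x) (Δ σ V (x ⊞ 3))
  Δ-near-inner σ = Δ-near-step σ V 3 ≤-refl (δ-near-inner σ) (δ-near-inner-across σ)

  Δ-near-spoke : ∀ σ x → Near (Δ σ U x) (Δ σ V x)
  Δ-near-spoke σ x = near-⊓ (δ-near-spoke σ x) (δ-near-spoke σ (n ∸ x))

  Δ≡0 : ∀ σ τ {x} → x < n → Δ σ τ x ≡ 0 → x ≡ 0 × σ ≡ τ
  Δ≡0 σ τ {x} x<n Δ≡0 with ⊓-sel (δ σ τ x) (δ σ τ (n ∸ x))
  ... | inj₁ Δ≡δx = δ≡0 σ τ x (trans (sym Δ≡δx) Δ≡0)
  ... | inj₂ Δ≡δ[n∸x] =
    ⊥-elim (<⇒≢ (m<n⇒0<n∸m x<n) (sym (proj₁ (δ≡0 σ τ (n ∸ x) (trans (sym Δ≡δ[n∸x]) Δ≡0)))))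

  Δ-mirror≤ : ∀ σ τ {z w} → z + w ≡ n → Δ σ τ (z % n) ≤ δ σ τ w
  Δ-mirror≤ σ τ {z} {w} z+w≡n with m≤n⇒m<n∨m≡n (subst (z ≤_) z+w≡n (m≤m+n z w))
  ... | inj₁ z<n = begin
    Δ σ τ (z % n)  ≡⟨ cong (Δ σ τ) (m<n⇒m%n≡m z<n) ⟩
    Δ σ τ z        ≤⟨ m⊓n≤n _ _ ⟩
    δ σ τ (n ∸ z)  ≡⟨ cong (λ m → δ σ τ (m ∸ z)) z+w≡n ⟨
    δ σ τ (z + w ∸ z) ≡⟨ cong (δ σ τ) (m+n∸m≡n z w) ⟩
    δ σ τ w        ∎
    where open ≤-Reasoning
  ... | inj₂ refl = begin
    Δ σ τ (n % n)  ≡⟨ cong (Δ σ τ) (n%n≡0 n) ⟩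
    Δ σ τ 0        ≤⟨ m⊓n≤m _ _ ⟩
    δ σ τ 0        ≡⟨ cong (δ σ τ) (+-cancelˡ-≡ n 0 w (trans (+-identityʳ n) (sym z+w≡n))) ⟩
    δ σ τ w        ∎
    where open ≤-Reasoning

  -- The descent goes towards offset 0, or away from it when the shorter way round passes n.
  CycleDescent : Layer → Layer → ℕ → Set
  CycleDescent σ τ x = ∃[ τ′ ] ∃[ d ] CoverEdge τ τ′ d ×
    ((d ≤ x × Δ σ τ′ (x ∸ d) < Δ σ τ x) ⊎ Δ σ τ′ (x ⊞ d) < Δ σ τ x)

  Δ-descent : ∀ σ τ {x} → x < n → 0 < Δ σ τ x → CycleDescent σ τ x
  Δ-descent σ τ {x} x<n Δ>0 with δ σ τ x ≤? δ σ τ (n ∸ x)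
  ... | yes δx≤δ[n∸x] = towards (δ-descent σ τ x (subst (0 <_) Δ≡δx Δ>0))
    where
      Δ≡δx : Δ σ τ x ≡ δ σ τ x
      Δ≡δx = m≤n⇒m⊓n≡m δx≤δ[n∸x]
      towards : Descent σ τ x → CycleDescent σ τ x
      towards (τ′ , d , e , d≤x , δ<) =
        τ′ , d , e , inj₁ (d≤x , subst (Δ σ τ′ (x ∸ d) <_) (sym Δ≡δx) (≤-<-trans (m⊓n≤m _ _) δ<))
  ... | no δx≰δ[n∸x] = away (δ-descent σ τ (n ∸ x) (subst (0 <_) Δ≡δ[n∸x] Δ>0))
    where
      Δ≡δ[n∸x] : Δ σ τ x ≡ δ σ τ (n ∸ x)
      Δ≡δ[n∸x] = m≥n⇒m⊓n≡n (<⇒≤ (≰⇒> δx≰δ[n∸x]))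
      x+d+[n∸x∸d]≡n : ∀ {d} → d ≤ n ∸ x → x + d + (n ∸ x ∸ d) ≡ n
      x+d+[n∸x∸d]≡n {d} d≤n∸x = begin
        x + d + (n ∸ x ∸ d)   ≡⟨ +-assoc x d _ ⟩
        x + (d + (n ∸ x ∸ d)) ≡⟨ cong (x +_) (m+[n∸m]≡n d≤n∸x) ⟩
        x + (n ∸ x)           ≡⟨ m+[n∸m]≡n (<⇒≤ x<n) ⟩
        n                     ∎
        where open ≡-Reasoning
      away : Descent σ τ (n ∸ x) → CycleDescent σ τ x
      away (τ′ , d , e , d≤n∸x , δ<) =
        τ′ , d , e , inj₂ (subst (Δ σ τ′ (x ⊞ d) <_) (sym Δ≡δ[n∸x])
                               (≤-<-trans (Δ-mirror≤ σ τ′ (x+d+[n∸x∸d]≡n d≤n∸x)) δ<))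

module _ {n : ℕ} where

  vertex : Layer → Fin n → PVtx n
  vertex U i = u i
  vertex V i = v i

  layer : PVtx n → Layer
  layer (u _) = U
  layer (v _) = V

  index : PVtx n → Fin n
  index (u i) = i
  index (v i) = i

  vertex-layer-index : ∀ x → vertex (layer x) (index x) ≡ x
  vertex-layer-index (u _) = refl
  vertex-layer-index (v _) = refl

  vertex-injective : ∀ {σ σ′ i i′} → vertex σ i ≡ vertex σ′ i′ → σ ≡ σ′ × i ≡ i′
  vertex-injective {U} {U} refl = refl , refl
  vertex-injective {V} {V} refl = refl , refl

  P3Adj-sym : .{{_ : NonZero n}} → Symmetric (P3Adj n)
  P3Adj-sym (outer i)  = outer' i
  P3Adj-sym (outer' i) = outer i
  P3Adj-sym (spoke i)  = spoke' i
  P3Adj-sym (spoke' i) = spoke i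
  P3Adj-sym (inner i)  = inner' i
  P3Adj-sym (inner' i) = inner i

module PetersenDistance (n : ℕ) .{{_ : NonZero n}} (41≤n : 41 ≤ n) where

  open Cyclic n
  open CycleDistance n 41≤n

  toℕ-⊕ : ∀ (i : Fin n) e → toℕ (i ⊕ e) ≡ toℕ i ⊞ e
  toℕ-⊕ i e = toℕ-fromℕ< _

  ⊕-inverse : ∀ (j : Fin n) {d} → d ≤ n → (j ⊕ (n ∸ d)) ⊕ d ≡ j
  ⊕-inverse j {d} d≤n = toℕ-injective (begin
    toℕ ((j ⊕ (n ∸ d)) ⊕ d)  ≡⟨ toℕ-⊕ (j ⊕ (n ∸ d)) d ⟩
    toℕ (j ⊕ (n ∸ d)) ⊞ d    ≡⟨ cong (_⊞ d) (toℕ-⊕ j (n ∸ d)) ⟩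
    (toℕ j ⊞ (n ∸ d)) ⊞ d    ≡⟨ ⊞-⊞-inverse (toℕ<n j) d≤n ⟩
    toℕ j                    ∎)
    where open ≡-Reasoning

  offset : Fin n → Fin n → ℕ
  offset s i = toℕ i ⊟ toℕ s

  offset<n : ∀ s i → offset s i < n
  offset<n s i = ⊟<n (toℕ i) (toℕ s)

  module _ (σ : Layer) (s : Fin n) where

    private
      s≤n : toℕ s ≤ n
      s≤n = <⇒≤ (toℕ<n s)

    potential : PVtx n → ℕ
    potential x = Δ σ (layer x) (offset s (index x))

    potential-vertex : ∀ τ j → potential (vertex τ j) ≡ Δ σ τ (offset s j)
    potential-vertex U j = refl
    potential-vertex V j = refl

    offset-⊕ : ∀ j e → offset s (j ⊕ e) ≡ offset s j ⊞ e
    offset-⊕ j e = trans (cong (_⊟ toℕ s) (toℕ-⊕ j e)) (⊞-⊟-assoc e (toℕ<n j) s≤n)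

    offset-⊖ : ∀ j {d} → d ≤ offset s j → offset s (j ⊕ (n ∸ d)) ≡ offset s j ∸ d
    offset-⊖ j d≤ = trans (cong (_⊟ toℕ s) (toℕ-⊕ j _)) (⊞-⊟-back (toℕ<n j) s≤n d≤)

    near-outer : ∀ j → Near (potential (u j)) (potential (u (j ⊕ 1)))
    near-outer j = subst (λ z → Near (Δ σ U (offset s j)) (Δ σ U z)) (sym (offset-⊕ j 1))
                         (Δ-near-outer σ (offset<n s j))

    near-inner : ∀ j → Near (potential (v j)) (potential (v (j ⊕ 3)))
    near-inner j = subst (λ z → Near (Δ σ V (offset s j)) (Δ σ V z)) (sym (offset-⊕ j 3))
                         (Δ-near-inner σ (offset<n s j))

    near-edge : ∀ {x y} → P3Adj n x y → Near (potential x) (potential y)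
    near-edge (outer j)  = near-outer j
    near-edge (outer' j) = near-sym (near-outer j)
    near-edge (spoke j)  = Δ-near-spoke σ _
    near-edge (spoke' j) = near-sym (Δ-near-spoke σ _)
    near-edge (inner j)  = near-inner j
    near-edge (inner' j) = near-sym (near-inner j)

    step-forward : ∀ {τ τ′ d} → CoverEdge τ τ′ d → ∀ j →
                   ∃[ y ] P3Adj n (vertex τ j) y × potential y ≡ Δ σ τ′ (offset s j ⊞ d)
    step-forward u-step   j = u (j ⊕ 1) , outer j , cong (Δ σ U) (offset-⊕ j 1)
    step-forward v-step   j = v (j ⊕ 3) , inner j , cong (Δ σ V) (offset-⊕ j 3)
    step-forward uv-spoke j = v j , spoke j , cong (Δ σ V) (sym (⊞-identityʳ (offset<n s j)))
    step-forward vu-spoke j = u j , spoke' j , cong (Δ σ U) (sym (⊞-identityʳ (offset<n s j)))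

    step-backward : ∀ {τ τ′ d} → CoverEdge τ τ′ d → ∀ j → d ≤ offset s j →
                    ∃[ y ] P3Adj n (vertex τ j) y × potential y ≡ Δ σ τ′ (offset s j ∸ d)
    step-backward u-step j d≤ =
      u (j ⊕ (n ∸ 1)) ,
      subst (λ i → P3Adj n (u i) (u (j ⊕ (n ∸ 1)))) (⊕-inverse j (≤-trans (s≤s z≤n) 41≤n))
            (outer' (j ⊕ (n ∸ 1))) ,
      cong (Δ σ U) (offset-⊖ j d≤)
    step-backward v-step j d≤ =
      v (j ⊕ (n ∸ 3)) ,
      subst (λ i → P3Adj n (v i) (v (j ⊕ (n ∸ 3)))) (⊕-inverse j (≤-trans (m≤m+n 3 38) 41≤n))
            (inner' (j ⊕ (n ∸ 3))) ,
      cong (Δ σ V) (offset-⊖ j d≤)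
    step-backward uv-spoke j _ = v j , spoke j , refl
    step-backward vu-spoke j _ = u j , spoke' j , refl

    private
      descend-via : ∀ x {m} → ∃[ y ] P3Adj n (vertex (layer x) (index x)) y × potential y ≡ m →
                    m < potential x → ∃[ y ] P3Adj n x y × potential y < potential x
      descend-via x (y , adj , refl) lt = y , subst (λ z → P3Adj n z y) (vertex-layer-index x) adj , lt

    potential-descent : ∀ x → 0 < potential x → ∃[ y ] P3Adj n x y × potential y < potential x
    potential-descent x pos with Δ-descent σ (layer x) (offset<n s (index x)) pos
    ... | _ , _ , e , inj₁ (d≤ , Δ<) = descend-via x (step-backward e (index x) d≤) Δ<
    ... | _ , _ , e , inj₂ Δ<        = descend-via x (step-forward e (index x)) Δ<

    vanishes-only-at-source : ∀ x → potential x ≡ 0 → x ≡ vertex σ s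
    vanishes-only-at-source x pot≡0 with Δ≡0 σ (layer x) (offset<n s (index x)) pot≡0
    ... | offset≡0 , refl = begin
      x                          ≡⟨ vertex-layer-index x ⟨
      vertex σ (index x)         ≡⟨ cong (vertex σ) (toℕ-injective index≡s) ⟩
      vertex σ s                 ∎
      where
        open ≡-Reasoning
        index≡s : toℕ (index x) ≡ toℕ s
        index≡s = begin
          toℕ (index x)              ≡⟨ ⊞-⊟ (toℕ<n (index x)) s≤n ⟨
          toℕ s ⊞ offset s (index x) ≡⟨ cong (toℕ s ⊞_) offset≡0 ⟩
          toℕ s ⊞ 0                  ≡⟨ ⊞-identityʳ (toℕ<n s) ⟩
          toℕ s                      ∎

    potential-at-source : potential (vertex σ s) ≡ 0
    potential-at-source = begin
      potential (vertex σ s)   ≡⟨ potential-vertex σ s ⟩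
      Δ σ σ (offset s s)       ≡⟨ cong (Δ σ σ) (⊟-self (toℕ<n s)) ⟩
      δ σ σ 0 ⊓ δ σ σ (n ∸ 0)  ≡⟨ cong (_⊓ δ σ σ n) (δ-self σ) ⟩
      0                        ∎
      where open ≡-Reasoning

    potential-is-distance : DistancePotential (vertex σ s) potential
    potential-is-distance = record
      { vanishes-at-target = potential-at-source
      ; vanishes-only-at-target = vanishes-only-at-source
      ; lipschitz = λ e → proj₁ (near-edge e)
      ; descent = potential-descent
      }

  distance-formula : ∀ σ s τ q → IsDist (P3Adj n) (vertex σ s) (vertex τ q) (Δ σ τ (offset s q))
  distance-formula σ s τ q =
    subst (IsDist (P3Adj n) (vertex σ s) (vertex τ q)) (potential-vertex σ s τ q)
      (IsDist-sym P3Adj-sym (potential-IsDist (potential-is-distance σ s) (vertex τ q)))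

-- Three landmarks leave two vertices unseparated

Point : Set
Point = Layer × ℕ

∀-layer? : {P : Layer → Set} → (∀ σ → Dec (P σ)) → Dec (∀ σ → P σ)
∀-layer? P? with P? U | P? V
... | yes pU | yes pV = yes λ { U → pU ; V → pV }
... | no ¬pU | _      = no λ p → ¬pU (p U)
... | yes _  | no ¬pV = no λ p → ¬pV (p V)

-- Up to offset 16 the distance in P(n,3) is the cover distance δ, for every n ≥ 41 (Δ-short).
FoolsNear : Point × Point → Point → Set
FoolsNear ((σ , s) , (σ′ , s′)) (τ , w) =
  ∣ w - s ∣ ≤ 16 × ∣ w - s′ ∣ ≤ 16 × δ σ τ ∣ w - s ∣ ≡ δ σ′ τ ∣ w - s′ ∣

foolsNear? : ∀ P l → Dec (FoolsNear P l)
foolsNear? ((σ , s) , (σ′ , s′)) (τ , w) =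
  (∣ w - s ∣ ≤? 16) ×-dec (∣ w - s′ ∣ ≤? 16) ×-dec (δ σ τ ∣ w - s ∣ ≟ δ σ′ τ ∣ w - s′ ∣)

layers : List Layer
layers = U ∷ V ∷ []

window-candidates : List (Point × Point)
window-candidates =
  concatMap (λ k → concatMap (λ s → concatMap (λ σ → map (λ σ′ → (σ , s) , (σ′ , s + k))
    layers) layers) (upTo 21)) (map (2 +_) (upTo 9))

WindowTwins : Point → Point → Point → Set
WindowTwins l₀ l₁ l₂ =
  Any (λ P → proj₂ (proj₁ P) < proj₂ (proj₂ P) × FoolsNear P l₀ × FoolsNear P l₁ × FoolsNear P l₂)
      window-candidates

-- Landmarks at 10, 10 + a, 10 + a + b: the offset 10 leaves room for twins left of the cluster.
window-twins : ∀ {a} → a < 10 → ∀ {b} → b < 10 → ∀ τ₀ τ₁ τ₂ →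
               WindowTwins (τ₀ , 10) (τ₁ , 10 + a) (τ₂ , 10 + (a + b))
window-twins = from-yes (allUpTo? (λ a → allUpTo? (λ b →
  ∀-layer? λ τ₀ → ∀-layer? λ τ₁ → ∀-layer? λ τ₂ →
  any? (λ P → (proj₂ (proj₁ P) <? proj₂ (proj₂ P)) ×-dec foolsNear? P (τ₀ , 10) ×-dec
              foolsNear? P (τ₁ , 10 + a) ×-dec foolsNear? P (τ₂ , 10 + (a + b)))
       window-candidates) 10) 10)

-- A base x for the twins u_{q+x}, u_{q+x+2}: the landmarks at q, q + G and q + H sit at offsets n − x,
-- G − x and H − x from u_{q+x}, none of which may be ≡ 2 (mod 3); recall n ≡ 2.
GapBase : ℕ → ℕ → Set
GapBase G H = ∃ λ x → x < 6 × 3 ≤ x × (x + 2) % 3 ≢ 2 × G % 3 ≢ (x + 2) % 3 × H % 3 ≢ (x + 2) % 3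

gapBase? : ∀ G H → Dec (GapBase G H)
gapBase? G H = anyUpTo? (λ x → (3 ≤? x) ×-dec ¬? ((x + 2) % 3 ≟ 2) ×-dec
                                 ¬? (G % 3 ≟ (x + 2) % 3) ×-dec ¬? (H % 3 ≟ (x + 2) % 3)) 6

GapBase-resp : ∀ {G G′ H H′} → G % 3 ≡ G′ % 3 → H % 3 ≡ H′ % 3 → GapBase G H → GapBase G′ H′
GapBase-resp G≡ H≡ (x , x<6 , 3≤x , x≢ , G≢ , H≢) =
  x , x<6 , 3≤x , x≢ , (λ eq → G≢ (trans G≡ eq)) , (λ eq → H≢ (trans H≡ eq))

gapBase-residues : ∀ {α} → α < 3 → ∀ {β} → β < 3 → ∀ {γ} → γ < 3 →
                   (α + β + γ) % 3 ≡ 2 → GapBase α (α + β) ⊎ GapBase β (β + γ)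
gapBase-residues = from-yes (allUpTo? (λ α → allUpTo? (λ β → allUpTo? (λ γ →
  ((α + β + γ) % 3 ≟ 2) →-dec (gapBase? α (α + β) ⊎-dec gapBase? β (β + γ))) 3) 3) 3)

gapBase-choice : ∀ X Y Z → (X + Y + Z) % 3 ≡ 2 → GapBase X (X + Y) ⊎ GapBase Y (Y + Z)
gapBase-choice X Y Z sum≡2 =
  Sum.map (GapBase-resp {X % 3} {X} {X % 3 + Y % 3} {X + Y} (m%n%n≡m%n X 3) (sym (%-distribˡ-+ X Y 3)))
          (GapBase-resp {Y % 3} {Y} {Y % 3 + Z % 3} {Y + Z} (m%n%n≡m%n Y 3) (sym (%-distribˡ-+ Y Z 3)))
          (gapBase-residues (m%n<n X 3) (m%n<n Y 3) (m%n<n Z 3) residues≡2)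
  where
    residues≡2 : (X % 3 + Y % 3 + Z % 3) % 3 ≡ 2
    residues≡2 = begin
      (X % 3 + Y % 3 + Z % 3) % 3       ≡⟨ [m%d+k]%d≡[m+k]%d (X % 3 + Y % 3) (Z % 3) 3 ⟨
      ((X % 3 + Y % 3) % 3 + Z % 3) % 3 ≡⟨ cong (λ r → (r + Z % 3) % 3) (%-distribˡ-+ X Y 3) ⟨
      ((X + Y) % 3 + Z % 3) % 3         ≡⟨ %-distribˡ-+ (X + Y) Z 3 ⟨
      (X + Y + Z) % 3                   ≡⟨ sum≡2 ⟩
      2                                 ∎
      where open ≡-Reasoning

rotate-sum : ∀ X Y Z {m} → X + Y + Z ≡ m → Y + Z + X ≡ m
rotate-sum X Y Z sum≡m = trans (+-comm (Y + Z) X) (trans (sym (+-assoc X Y Z)) sum≡m)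

SameSide : ℕ → ℕ → Set
SameSide X Y = (X ≤ 9 × Y ≤ 9) ⊎ (10 ≤ X × 10 ≤ Y)

same-side-pigeonhole : ∀ X Y Z → SameSide X Y ⊎ SameSide Y Z ⊎ SameSide Z X
same-side-pigeonhole X Y Z with X ≤? 9 | Y ≤? 9 | Z ≤? 9
... | yes X≤9 | yes Y≤9 | _       = inj₁ (inj₁ (X≤9 , Y≤9))
... | no X≰9  | no Y≰9  | _       = inj₁ (inj₂ (≰⇒> X≰9 , ≰⇒> Y≰9))
... | yes X≤9 | no _    | yes Z≤9 = inj₂ (inj₂ (inj₁ (Z≤9 , X≤9)))
... | yes _   | no Y≰9  | no Z≰9  = inj₂ (inj₁ (inj₂ (≰⇒> Y≰9 , ≰⇒> Z≰9)))
... | no _    | yes Y≤9 | yes Z≤9 = inj₂ (inj₁ (inj₁ (Y≤9 , Z≤9)))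
... | no X≰9  | yes _   | no Z≰9  = inj₂ (inj₂ (inj₂ (≰⇒> Z≰9 , ≰⇒> X≰9)))

module NoResolvingTriple (n : ℕ) .{{_ : NonZero n}} (41≤n : 41 ≤ n) (n%3≡2 : n % 3 ≡ 2) where

  open Cyclic n
  open CycleDistance n 41≤n

  dist : Point → Point → ℕ
  dist (σ , s) (τ , w) = Δ σ τ (w ⊟ s)

  record Twins : Set where
    constructor twins
    field
      first second : Point
      first<n : proj₂ first < n
      second<n : proj₂ second < n
      distinct : first ≢ second

  Confuses : Twins → Point → Set
  Confuses T l = dist (Twins.first T) l ≡ dist (Twins.second T) l

  Unresolved : Point → Point → Point → Set
  Unresolved l₁ l₂ l₃ = Σ Twins λ T → Confuses T l₁ × Confuses T l₂ × Confuses T l₃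

  Unresolved-rotate : ∀ {l₁ l₂ l₃} → Unresolved l₂ l₃ l₁ → Unresolved l₁ l₂ l₃
  Unresolved-rotate (T , c₂ , c₃ , c₁) = T , c₁ , c₂ , c₃

  Unresolved-swap : ∀ {l₁ l₂ l₃} → Unresolved l₁ l₃ l₂ → Unresolved l₁ l₂ l₃
  Unresolved-swap (T , c₁ , c₃ , c₂) = T , c₁ , c₂ , c₃

  private
    <n : ∀ {m} → m ≤ 40 → m < n
    <n m≤40 = ≤-trans (s≤s m≤40) 41≤n

  -- Either way round the cycle the offsets compared are y and 2 + y, resp. z and 2 + z, with 3 ∤ y, z.
  Δ-twin : ∀ τ {r} → 5 ≤ r → r + 3 ≤ n → r % 3 ≢ 2 → Δ U τ r ≡ Δ U τ (r ∸ 2)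
  Δ-twin τ {r} 5≤r r+3≤n r≢2 = begin
    δ U τ r ⊓ δ U τ z           ≡⟨ cong (λ a → δ U τ a ⊓ δ U τ z) r≡2+y ⟩
    δ U τ (2 + y) ⊓ δ U τ z     ≡⟨ cong₂ _⊓_ (δU-2+ τ 3≤y y≢0) (sym (δU-2+ τ 3≤z z≢0)) ⟩
    δ U τ y ⊓ δ U τ (2 + z)     ≡⟨ cong (λ b → δ U τ y ⊓ δ U τ b) n∸y≡2+z ⟨
    δ U τ y ⊓ δ U τ (n ∸ y)     ∎
    where
      open ≡-Reasoning
      y : ℕ
      y = r ∸ 2
      z : ℕ
      z = n ∸ r
      r≡2+y : r ≡ 2 + y
      r≡2+y = sym (m+[n∸m]≡n (≤-trans (s≤s (s≤s z≤n)) 5≤r))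
      r+z≡n : r + z ≡ n
      r+z≡n = m+[n∸m]≡n (≤-trans (m≤m+n r 3) r+3≤n)
      n∸y≡2+z : n ∸ y ≡ 2 + z
      n∸y≡2+z = begin
        n ∸ y             ≡⟨ cong (_∸ y) r+z≡n ⟨
        r + z ∸ y         ≡⟨ cong (λ a → a + z ∸ y) (trans r≡2+y (+-comm 2 y)) ⟩
        y + 2 + z ∸ y     ≡⟨ cong (_∸ y) (+-assoc y 2 z) ⟩
        y + (2 + z) ∸ y   ≡⟨ m+n∸m≡n y (2 + z) ⟩
        2 + z             ∎
      3≤y : 3 ≤ y
      3≤y = ∸-monoˡ-≤ 2 5≤r
      3≤z : 3 ≤ z
      3≤z = subst (_≤ z) (m+n∸m≡n r 3) (∸-monoˡ-≤ r r+3≤n)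
      y≢0 : y % 3 ≢ 0
      y≢0 y≡0 = r≢2 (trans (cong (_% 3) r≡2+y) (%-remove-+ʳ 2 (m%n≡0⇒n∣m y 3 y≡0)))
      z≢0 : z % 3 ≢ 0
      z≢0 z≡0 = r≢2 (trans (sym (%-remove-+ʳ r (m%n≡0⇒n∣m z 3 z≡0))) (trans (cong (_% 3) r+z≡n) n%3≡2))

  outer-twins : ∀ {t} → t < n → Twins
  outer-twins {t} t<n = twins (U , t) (U , t ⊞ 2) t<n (⊞<n t 2) λ eq →
    0≢2 (⊞-cancelˡ (<⇒≤ t<n) (<n z≤n) (<n (s≤s (s≤s z≤n))) (trans (⊞-identityʳ t<n) (,-injectiveʳ eq)))
    where
      0≢2 : 0 ≢ 2
      0≢2 ()

  outer-twins-confused : ∀ τ {q x P} (q<n : q < n) → 3 ≤ x → x + 5 ≤ P → P ≤ n → P % 3 ≢ (x + 2) % 3 →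
                         Confuses (outer-twins (⊞<n q x)) (τ , q ⊞ P)
  outer-twins-confused τ {q} {x} {P} q<n 3≤x x+5≤P P≤n P≢ = begin
    Δ U τ ((q ⊞ P) ⊟ t)         ≡⟨ cong (λ a → Δ U τ (a ⊟ t)) q⊞P≡t⊞r ⟩
    Δ U τ ((t ⊞ r) ⊟ t)         ≡⟨ cong (Δ U τ) (⊞-⊟-cancel (<⇒≤ (⊞<n q x)) r<n) ⟩
    Δ U τ r                     ≡⟨ Δ-twin τ 5≤r r+3≤n r≢2 ⟩
    Δ U τ (r ∸ 2)               ≡⟨ cong (Δ U τ) (⊞-⊟-cancel (<⇒≤ (⊞<n t 2)) (≤-<-trans (m∸n≤m r 2) r<n)) ⟨
    Δ U τ (((t ⊞ 2) ⊞ (r ∸ 2)) ⊟ (t ⊞ 2)) ≡⟨ cong (λ a → Δ U τ (a ⊟ (t ⊞ 2))) t⊞r≡ ⟩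
    Δ U τ ((t ⊞ r) ⊟ (t ⊞ 2))   ≡⟨ cong (λ a → Δ U τ (a ⊟ (t ⊞ 2))) q⊞P≡t⊞r ⟨
    Δ U τ ((q ⊞ P) ⊟ (t ⊞ 2))   ∎
    where
      open ≡-Reasoning
      t : ℕ
      t = q ⊞ x
      r : ℕ
      r = P ∸ x
      x+r≡P : x + r ≡ P
      x+r≡P = m+[n∸m]≡n (≤-trans (m≤m+n x 5) x+5≤P)
      5≤r : 5 ≤ r
      5≤r = subst (_≤ r) (m+n∸m≡n x 5) (∸-monoˡ-≤ x x+5≤P)
      r+3≤n : r + 3 ≤ n
      r+3≤n = ≤-trans (+-monoʳ-≤ r 3≤x) (subst (_≤ n) (sym (trans (+-comm r x) x+r≡P)) P≤n)
      r<n : r < n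
      r<n = ≤-trans (m<m+n r (s≤s z≤n)) r+3≤n
      r≢2 : r % 3 ≢ 2
      r≢2 r≡2 = P≢ (begin
        P % 3               ≡⟨ cong (_% 3) x+r≡P ⟨
        (x + r) % 3         ≡⟨ [m+k%d]%d≡[m+k]%d x r 3 ⟨
        (x + r % 3) % 3     ≡⟨ cong (λ a → (x + a) % 3) r≡2 ⟩
        (x + 2) % 3         ∎)
      q⊞P≡t⊞r : q ⊞ P ≡ t ⊞ r
      q⊞P≡t⊞r = trans (cong (q ⊞_) (sym x+r≡P)) (sym (⊞-assoc q x r))
      t⊞r≡ : (t ⊞ 2) ⊞ (r ∸ 2) ≡ t ⊞ r
      t⊞r≡ = trans (⊞-assoc t 2 (r ∸ 2)) (cong (t ⊞_) (m+[n∸m]≡n (≤-trans (s≤s (s≤s z≤n)) 5≤r)))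

  gap-twins : ∀ τ₀ τ₁ τ₂ {q G G′} → q < n → 10 ≤ G → G + G′ ≤ n → GapBase G (G + G′) →
              Unresolved (τ₀ , q) (τ₁ , q ⊞ G) (τ₂ , q ⊞ (G + G′))
  gap-twins τ₀ τ₁ τ₂ {q} {G} {G′} q<n 10≤G G+G′≤n (x , x<6 , 3≤x , x+2≢2 , G≢ , G+G′≢) =
    outer-twins (⊞<n q x) ,
    subst (λ m → Confuses (outer-twins (⊞<n q x)) (τ₀ , m)) q⊞n≡q
      (outer-twins-confused τ₀ q<n 3≤x (≤-trans x+5≤G G≤n) ≤-refl n≢) ,
    outer-twins-confused τ₁ q<n 3≤x x+5≤G G≤n G≢ ,
    outer-twins-confused τ₂ q<n 3≤x (≤-trans x+5≤G (m≤m+n G G′)) G+G′≤n G+G′≢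
    where
      x+5≤G : x + 5 ≤ G
      x+5≤G = ≤-trans (+-monoˡ-≤ 5 (≤-pred x<6)) 10≤G
      G≤n : G ≤ n
      G≤n = ≤-trans (m≤m+n G G′) G+G′≤n
      n≢ : n % 3 ≢ (x + 2) % 3
      n≢ eq = x+2≢2 (trans (sym eq) n%3≡2)
      q⊞n≡q : q ⊞ n ≡ q
      q⊞n≡q = trans (⊞-+n q 0) (⊞-identityʳ q<n)

  window-dist : ∀ σ τ {s w} → s ≤ 40 → w ≤ 40 → ∣ w - s ∣ ≤ 16 →
                Δ σ τ (w ⊟ s) ≡ δ σ τ ∣ w - s ∣
  window-dist σ τ {s} {w} s≤40 w≤40 near with s ≤? w
  ... | yes s≤w = begin
    Δ σ τ (w ⊟ s)   ≡⟨ cong (Δ σ τ) (⊟-unique (<⇒≤ (<n s≤40)) w∸s<n s⊞[w∸s]≡w) ⟩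
    Δ σ τ (w ∸ s)   ≡⟨ Δ-short σ τ (subst (_≤ 16) ∣w-s∣≡w∸s near) (<⇒≤ w∸s<n) ⟩
    δ σ τ (w ∸ s)   ≡⟨ cong (δ σ τ) ∣w-s∣≡w∸s ⟨
    δ σ τ ∣ w - s ∣ ∎
    where
      open ≡-Reasoning
      w∸s<n : w ∸ s < n
      w∸s<n = ≤-<-trans (m∸n≤m w s) (<n w≤40)
      ∣w-s∣≡w∸s : ∣ w - s ∣ ≡ w ∸ s
      ∣w-s∣≡w∸s = m≤n⇒∣n-m∣≡n∸m s≤w
      s⊞[w∸s]≡w : s ⊞ (w ∸ s) ≡ w
      s⊞[w∸s]≡w = trans (cong (_% n) (m+[n∸m]≡n s≤w)) (m<n⇒m%n≡m (<n w≤40))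
  ... | no s≰w = begin
    Δ σ τ (w ⊟ s)     ≡⟨ cong (Δ σ τ) (⊟-unique (<⇒≤ (<n s≤40)) n∸e<n s⊞[n∸e]≡w) ⟩
    Δ σ τ (n ∸ e)     ≡⟨ Δ-short-back σ τ (subst (_≤ 16) ∣w-s∣≡e near) e≤n ⟩
    δ σ τ e           ≡⟨ cong (δ σ τ) ∣w-s∣≡e ⟨
    δ σ τ ∣ w - s ∣   ∎
    where
      open ≡-Reasoning
      w<s : w < s
      w<s = ≰⇒> s≰w
      e : ℕ
      e = s ∸ w
      e≤n : e ≤ n
      e≤n = ≤-trans (m∸n≤m s w) (<⇒≤ (<n s≤40))
      n∸e<n : n ∸ e < n
      n∸e<n = ∸-monoʳ-< (m<n⇒0<n∸m w<s) e≤n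
      ∣w-s∣≡e : ∣ w - s ∣ ≡ e
      ∣w-s∣≡e = trans (∣-∣-comm w s) (m≤n⇒∣n-m∣≡n∸m (<⇒≤ w<s))
      s⊞[n∸e]≡w : s ⊞ (n ∸ e) ≡ w
      s⊞[n∸e]≡w = begin
        (s + (n ∸ e)) % n         ≡⟨ cong (λ a → (a + (n ∸ e)) % n) (m+[n∸m]≡n (<⇒≤ w<s)) ⟨
        (w + e + (n ∸ e)) % n     ≡⟨ cong (_% n) (+-assoc w e (n ∸ e)) ⟩
        (w + (e + (n ∸ e))) % n   ≡⟨ cong (λ a → (w + a) % n) (m+[n∸m]≡n e≤n) ⟩
        (w + n) % n               ≡⟨ [m+n]%n≡m%n w n ⟩
        w % n                     ≡⟨ m<n⇒m%n≡m (<n w≤40) ⟩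
        w                         ∎

  module _ {q} (q<n : q < n) where

    private
      z : ℕ
      z = q ⊞ (n ∸ 10)

      z⊞[10+m]≡q⊞m : ∀ m → z ⊞ (10 + m) ≡ q ⊞ m
      z⊞[10+m]≡q⊞m m = begin
        (q ⊞ (n ∸ 10)) ⊞ (10 + m)   ≡⟨ ⊞-assoc q (n ∸ 10) (10 + m) ⟩
        q ⊞ ((n ∸ 10) + (10 + m))   ≡⟨ cong (q ⊞_) (+-assoc (n ∸ 10) 10 m) ⟨
        q ⊞ ((n ∸ 10) + 10 + m)     ≡⟨ cong (λ a → q ⊞ (a + m)) (m∸n+n≡m (≤-trans (m≤m+n 10 31) 41≤n)) ⟩
        q ⊞ (n + m)                 ≡⟨ cong (q ⊞_) (+-comm n m) ⟩
        q ⊞ (m + n)                 ≡⟨ ⊞-+n q m ⟩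
        q ⊞ m                       ∎
        where open ≡-Reasoning

      shifted-confuses : ∀ σ s σ′ s′ τ w → s ≤ 40 → s′ ≤ 40 → w ≤ 40 →
                         FoolsNear ((σ , s) , (σ′ , s′)) (τ , w) →
                         dist (σ , z ⊞ s) (τ , z ⊞ w) ≡ dist (σ′ , z ⊞ s′) (τ , z ⊞ w)
      shifted-confuses σ s σ′ s′ τ w s≤40 s′≤40 w≤40 (near , near′ , δ≡δ′) = begin
        Δ σ τ ((z ⊞ w) ⊟ (z ⊞ s))    ≡⟨ cong (Δ σ τ) (⊞-⊟-shift z (<n w≤40) (<n s≤40)) ⟩
        Δ σ τ (w ⊟ s)                ≡⟨ window-dist σ τ s≤40 w≤40 near ⟩
        δ σ τ ∣ w - s ∣              ≡⟨ δ≡δ′ ⟩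
        δ σ′ τ ∣ w - s′ ∣            ≡⟨ window-dist σ′ τ s′≤40 w≤40 near′ ⟨
        Δ σ′ τ (w ⊟ s′)              ≡⟨ cong (Δ σ′ τ) (⊞-⊟-shift z (<n w≤40) (<n s′≤40)) ⟨
        Δ σ′ τ ((z ⊞ w) ⊟ (z ⊞ s′))  ∎
        where open ≡-Reasoning

      near-10 : ∀ {s} → ∣ 10 - s ∣ ≤ 16 → s ≤ 40
      near-10 {s} near = ≤-trans (m≤n+∣n-m∣ s 10) (≤-trans (+-monoʳ-≤ 10 near) (m≤m+n 26 14))

    cluster-twins : ∀ τ₀ τ₁ τ₂ {a b} → a ≤ 9 → b ≤ 9 →
                    Unresolved (τ₀ , q) (τ₁ , q ⊞ a) (τ₂ , q ⊞ (a + b))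
    cluster-twins τ₀ τ₁ τ₂ {a} {b} a≤9 b≤9 =
      from-window (satisfied (window-twins (s≤s a≤9) (s≤s b≤9) τ₀ τ₁ τ₂))
      where
        l₁≤40 : 10 + a ≤ 40
        l₁≤40 = +-monoʳ-≤ 10 (≤-trans a≤9 (m≤m+n 9 21))
        l₂≤40 : 10 + (a + b) ≤ 40
        l₂≤40 = +-monoʳ-≤ 10 (≤-trans (+-mono-≤ a≤9 b≤9) (m≤m+n 18 12))
        from-window : (∃ λ P → proj₂ (proj₁ P) < proj₂ (proj₂ P) × FoolsNear P (τ₀ , 10) ×
                               FoolsNear P (τ₁ , 10 + a) × FoolsNear P (τ₂ , 10 + (a + b))) →
                      Unresolved (τ₀ , q) (τ₁ , q ⊞ a) (τ₂ , q ⊞ (a + b))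
        from-window (((σ , s) , (σ′ , s′)) , s<s′ , f₀ , f₁ , f₂) =
          T ,
          subst (λ m → Confuses T (τ₀ , m)) (trans (z⊞[10+m]≡q⊞m 0) (⊞-identityʳ q<n))
            (shifted-confuses σ s σ′ s′ τ₀ 10 s≤40 s′≤40 (m≤m+n 10 30) f₀) ,
          subst (λ m → Confuses T (τ₁ , m)) (z⊞[10+m]≡q⊞m a)
            (shifted-confuses σ s σ′ s′ τ₁ (10 + a) s≤40 s′≤40 l₁≤40 f₁) ,
          subst (λ m → Confuses T (τ₂ , m)) (z⊞[10+m]≡q⊞m (a + b))
            (shifted-confuses σ s σ′ s′ τ₂ (10 + (a + b)) s≤40 s′≤40 l₂≤40 f₂)
          where
            s≤40 : s ≤ 40
            s≤40 = near-10 (proj₁ f₀)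
            s′≤40 : s′ ≤ 40
            s′≤40 = near-10 (proj₁ (proj₂ f₀))
            T : Twins
            T = twins (σ , z ⊞ s) (σ′ , z ⊞ s′) (⊞<n z s) (⊞<n z s′) λ eq →
                  <⇒≢ s<s′ (⊞-cancelˡ (<⇒≤ (⊞<n q (n ∸ 10))) (<n s≤40) (<n s′≤40) (,-injectiveʳ eq))

  rotate-gaps : ∀ {τ₀ τ₁ τ₂ q X Y Z} → q < n → X + Y + Z ≡ n →
                Unresolved (τ₁ , q ⊞ X) (τ₂ , (q ⊞ X) ⊞ Y) (τ₀ , (q ⊞ X) ⊞ (Y + Z)) →
                Unresolved (τ₀ , q) (τ₁ , q ⊞ X) (τ₂ , q ⊞ (X + Y))
  rotate-gaps {τ₀} {τ₁} {τ₂} {q} {X} {Y} {Z} q<n sum≡n =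
    Unresolved-rotate ∘ subst₂ (λ a b → Unresolved (τ₁ , q ⊞ X) (τ₂ , a) (τ₀ , b)) (⊞-assoc q X Y) around
    where
      around : (q ⊞ X) ⊞ (Y + Z) ≡ q
      around = begin
        (q ⊞ X) ⊞ (Y + Z) ≡⟨ ⊞-assoc q X (Y + Z) ⟩
        q ⊞ (X + (Y + Z)) ≡⟨ cong (q ⊞_) (trans (sym (+-assoc X Y Z)) sum≡n) ⟩
        q ⊞ n             ≡⟨ ⊞-+n q 0 ⟩
        q ⊞ 0             ≡⟨ ⊞-identityʳ q<n ⟩
        q                 ∎
        where open ≡-Reasoning

  same-side-twins : ∀ τ₀ τ₁ τ₂ {q X Y Z} → q < n → X + Y + Z ≡ n → SameSide X Y →
                    Unresolved (τ₀ , q) (τ₁ , q ⊞ X) (τ₂ , q ⊞ (X + Y))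
  same-side-twins τ₀ τ₁ τ₂ q<n sum≡n (inj₁ (X≤9 , Y≤9)) = cluster-twins q<n τ₀ τ₁ τ₂ X≤9 Y≤9
  same-side-twins τ₀ τ₁ τ₂ {q} {X} {Y} {Z} q<n sum≡n (inj₂ (10≤X , 10≤Y)) =
    Sum.[ gap-twins τ₀ τ₁ τ₂ q<n 10≤X (subst (X + Y ≤_) sum≡n (m≤m+n (X + Y) Z))
        , rotate-gaps q<n sum≡n ∘
            gap-twins τ₁ τ₂ τ₀ (⊞<n q X) 10≤Y (subst (Y + Z ≤_) (rotate-sum X Y Z sum≡n) (m≤m+n (Y + Z) X))
        ]′ (gapBase-choice X Y Z (trans (cong (_% 3) sum≡n) n%3≡2))

  unresolved-gaps : ∀ τ₀ τ₁ τ₂ {q X Y Z} → q < n → X + Y + Z ≡ n →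
                    Unresolved (τ₀ , q) (τ₁ , q ⊞ X) (τ₂ , q ⊞ (X + Y))
  unresolved-gaps τ₀ τ₁ τ₂ {q} {X} {Y} {Z} q<n sum≡n with same-side-pigeonhole X Y Z
  ... | inj₁ XY = same-side-twins τ₀ τ₁ τ₂ q<n sum≡n XY
  ... | inj₂ (inj₁ YZ) = rotate-gaps q<n sum≡n (same-side-twins τ₁ τ₂ τ₀ (⊞<n q X) YZX≡n YZ)
    where
      YZX≡n : Y + Z + X ≡ n
      YZX≡n = rotate-sum X Y Z sum≡n
  ... | inj₂ (inj₂ ZX) =
    rotate-gaps q<n sum≡n (rotate-gaps (⊞<n q X) YZX≡n (same-side-twins τ₂ τ₀ τ₁ (⊞<n (q ⊞ X) Y) ZXY≡n ZX))
    where
      YZX≡n : Y + Z + X ≡ n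
      YZX≡n = rotate-sum X Y Z sum≡n
      ZXY≡n : Z + X + Y ≡ n
      ZXY≡n = rotate-sum Y Z X YZX≡n

  unresolved-ordered : ∀ τ₁ τ₂ τ₃ {p o₂ o₃} → p < n → o₂ ≤ o₃ → o₃ < n →
                       Unresolved (τ₁ , p) (τ₂ , p ⊞ o₂) (τ₃ , p ⊞ o₃)
  unresolved-ordered τ₁ τ₂ τ₃ {p} {o₂} {o₃} p<n o₂≤o₃ o₃<n =
    subst (λ m → Unresolved (τ₁ , p) (τ₂ , p ⊞ o₂) (τ₃ , p ⊞ m)) (m+[n∸m]≡n o₂≤o₃)
      (unresolved-gaps τ₁ τ₂ τ₃ p<n
        (trans (cong (_+ (n ∸ o₃)) (m+[n∸m]≡n o₂≤o₃)) (m+[n∸m]≡n (<⇒≤ o₃<n))))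

  unresolved : ∀ τ₁ τ₂ τ₃ {p₁ p₂ p₃} → p₁ < n → p₂ < n → p₃ < n →
               Unresolved (τ₁ , p₁) (τ₂ , p₂) (τ₃ , p₃)
  unresolved τ₁ τ₂ τ₃ {p₁} {p₂} {p₃} p₁<n p₂<n p₃<n with (p₂ ⊟ p₁) ≤? (p₃ ⊟ p₁)
  ... | yes o₂≤o₃ =
    subst₂ (λ a b → Unresolved (τ₁ , p₁) (τ₂ , a) (τ₃ , b)) (⊞-⊟ p₂<n (<⇒≤ p₁<n)) (⊞-⊟ p₃<n (<⇒≤ p₁<n))
      (unresolved-ordered τ₁ τ₂ τ₃ p₁<n o₂≤o₃ (⊟<n p₃ p₁))
  ... | no o₂≰o₃ = Unresolved-swap
    (subst₂ (λ a b → Unresolved (τ₁ , p₁) (τ₃ , a) (τ₂ , b)) (⊞-⊟ p₃<n (<⇒≤ p₁<n)) (⊞-⊟ p₂<n (<⇒≤ p₁<n))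
      (unresolved-ordered τ₁ τ₃ τ₂ p₁<n (<⇒≤ (≰⇒> o₂≰o₃)) (⊟<n p₂ p₁)))

module _ (n : ℕ) .{{_ : NonZero n}} (41≤n : 41 ≤ n) (n%3≡2 : n % 3 ≡ 2) where

  open Cyclic n
  open CycleDistance n 41≤n
  open PetersenDistance n 41≤n
  open NoResolvingTriple n 41≤n n%3≡2

  private
    landmark : PVtx n → Point
    landmark w = layer w , toℕ (index w)

    twin-vertex : (p : Point) → proj₂ p < n → PVtx n
    twin-vertex (σ , s) s<n = vertex σ (fromℕ< s<n)

    twin-vertex-injective : ∀ p (p<n : proj₂ p < n) p′ (p′<n : proj₂ p′ < n) →
                            twin-vertex p p<n ≡ twin-vertex p′ p′<n → p ≡ p′
    twin-vertex-injective (σ , s) s<n (σ′ , s′) s′<n eq with vertex-injective eq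
    ... | σ≡σ′ , i≡i′ = cong₂ _,_ σ≡σ′ (begin
      s                 ≡⟨ toℕ-fromℕ< s<n ⟨
      toℕ (fromℕ< s<n)  ≡⟨ cong toℕ i≡i′ ⟩
      toℕ (fromℕ< s′<n) ≡⟨ toℕ-fromℕ< s′<n ⟩
      s′                ∎)
      where open ≡-Reasoning

    IsDist-twin-vertex : ∀ p (p<n : proj₂ p < n) w → IsDist (P3Adj n) (twin-vertex p p<n) w (dist p (landmark w))
    IsDist-twin-vertex (σ , s) s<n w =
      subst₂ (IsDist (P3Adj n) (vertex σ (fromℕ< s<n))) (vertex-layer-index w)
        (cong (λ a → Δ σ (layer w) (toℕ (index w) ⊟ a)) (toℕ-fromℕ< s<n))
        (distance-formula σ (fromℕ< s<n) (layer w) (index w))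

  triple-not-resolving : ∀ w₁ w₂ w₃ {W} → W ⊆ w₁ ∷ w₂ ∷ w₃ ∷ [] → ¬ Resolving (P3Adj n) W
  triple-not-resolving w₁ w₂ w₃ {W} W⊆ resolving =
    distinct (twin-vertex-injective first first<n second second<n (resolving a b confused-by-W))
    where
      twins-and-confusions : Unresolved (landmark w₁) (landmark w₂) (landmark w₃)
      twins-and-confusions = unresolved (layer w₁) (layer w₂) (layer w₃)
                               (toℕ<n (index w₁)) (toℕ<n (index w₂)) (toℕ<n (index w₃))
      T : Twins
      T = proj₁ twins-and-confusions
      open Twins T
      a : PVtx n
      a = twin-vertex first first<n
      b : PVtx n
      b = twin-vertex second second<n
      same-distances : ∀ w → Confuses T (landmark w) → SameDist (P3Adj n) w a b
      same-distances w confused =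
        dist first (landmark w) , IsDist-twin-vertex first first<n w ,
        subst (IsDist (P3Adj n) b w) (sym confused) (IsDist-twin-vertex second second<n w)
      confused-by-W : ∀ w → w ∈ W → SameDist (P3Adj n) w a b
      confused-by-W w w∈W with W⊆ w∈W | proj₂ twins-and-confusions
      ... | here refl                 | c₁ , _  , _  = same-distances w c₁
      ... | there (here refl)         | _  , c₂ , _  = same-distances w c₂
      ... | there (there (here refl)) | _  , _  , c₃ = same-distances w c₃

  resolving⇒4≤length : ∀ W → Resolving (P3Adj n) W → 4 ≤ length W
  resolving⇒4≤length (_ ∷ _ ∷ _ ∷ _ ∷ _) _ = s≤s (s≤s (s≤s (s≤s z≤n)))
  resolving⇒4≤length [] resolving = ⊥-elim (triple-not-resolving w₀ w₀ w₀ (λ ()) resolving)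
    where
      w₀ : PVtx n
      w₀ = u (fromℕ< (≤-trans (s≤s z≤n) 41≤n))
  resolving⇒4≤length (w₁ ∷ []) resolving =
    ⊥-elim (triple-not-resolving w₁ w₁ w₁ (λ { (here e) → here e }) resolving)
  resolving⇒4≤length (w₁ ∷ w₂ ∷ []) resolving =
    ⊥-elim (triple-not-resolving w₁ w₂ w₂ (λ { (here e) → here e ; (there (here e)) → there (here e) }) resolving)
  resolving⇒4≤length (w₁ ∷ w₂ ∷ w₃ ∷ []) resolving = ⊥-elim (triple-not-resolving w₁ w₂ w₃ id resolving)

theorem3 : (k : ℕ) → 6 ≤ k → (W : List (PVtx (5 + 6 * k))) → Unique W →
    Resolving (P3Adj (5 + 6 * k)) W → 4 ≤ length W
theorem3 k 6≤k W _ = resolving⇒4≤length (5 + 6 * k) 41≤n n%3≡2 W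
  where
    41≤n : 41 ≤ 5 + 6 * k
    41≤n = +-monoʳ-≤ 5 (*-monoʳ-≤ 6 6≤k)
    n%3≡2 : (5 + 6 * k) % 3 ≡ 2
    n%3≡2 = trans (cong (λ m → (5 + m) % 3) (trans (*-assoc 3 2 k) (*-comm 3 (2 * k)))) ([m+kn]%n≡m%n 5 (2 * k) 3)
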